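{- Let $\mathbb{K}_{2,\omega}$ be the graph with vertex set $K_{2,\omega}=A_{+1}\sqcup A_{ -1}$ ($A_{\pm1}$ disjoint countably infinite sets) and edge relation $A_{ -1}\times A_{+1}\cup A_{+1}\times A_{ -1}$, and let $\mathbb{G}$ be the structure on $G=\mathbb{N}\times K_{2,\omega}$ with binary relations $E_1=\{((i,x),(j,y)):i\neq j\}$ and $E_2=\{((i,x),(j,y)): i=j,\ (x,y)\text{ an edge of }\mathbb{K}_{2,\omega}\}$. Then (i) $\mathrm{End}(\mathbb{G})=\{\bigsqcup^{\tau}_{i\in\mathbb{N}}s_i:\tau\in\mathrm{Inj}(\mathbb{N}),\ s_i\in\mathrm{End}(\mathbb{K}_{2,\omega})\text{ for all }i\}$; (ii) $\mathrm{Aut}(\mathbb{G})=\{\bigsqcup^{\sigma}_{i\in\mathbb{N}}\alpha_i:\sigma\in\mathrm{Sym}(\mathbb{N}),\ \alpha_i\in\mathrm{Aut}(\mathbb{K}_{2,\omega})\text{ for all }i\}$.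
   Context: $\mathrm{Inj}(\mathbb{N})$ is the set of injective maps $\mathbb{N}\to\mathbb{N}$, $\mathrm{Sym}(\mathbb{N})$ the set of bijections. For $\tau\colon\mathbb{N}\to\mathbb{N}$ and maps $s_i\colon X\to X$ ($i\in\mathbb{N}$), $\bigsqcup^{\tau}_{i\in\mathbb{N}}s_i$ denotes the map $\mathbb{N}\times X\to\mathbb{N}\times X$, $(i,x)\mapsto(\tau(i),s_i(x))$. -}

module Defs where

open import Data.Nat using (ℕ)
open import Data.Bool using (Bool)
open import Data.Product using (_×_; _,_; Σ; ∃)
open import Relation.Binary.PropositionalEquality using (_≡_; _≢_)
open import Function.Definitions using (Injective; Bijective)
open import Function.Bundles using (_⇔_)

-- Vertex set of 𝕂_{2,ω}: A_{+1} = {true} × ℕ, A_{-1} = {false} × ℕ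
K : Set
K = Bool × ℕ

Edge : K → K → Set
Edge (a , _) (b , _) = a ≢ b

IsEndK : (K → K) → Set
IsEndK s = ∀ x y → Edge x y → Edge (s x) (s y)

IsAutK : (K → K) → Set
IsAutK s = Bijective _≡_ _≡_ s × (∀ x y → Edge x y ⇔ Edge (s x) (s y))

G : Set
G = ℕ × K

E₁ : G → G → Set
E₁ (i , _) (j , _) = i ≢ j

E₂ : G → G → Set
E₂ (i , x) (j , y) = (i ≡ j) × Edge x y

IsEndG : (G → G) → Set
IsEndG f = (∀ p q → E₁ p q → E₁ (f p) (f q)) × (∀ p q → E₂ p q → E₂ (f p) (f q))

IsAutG : (G → G) → Set
IsAutG f = Bijective _≡_ _≡_ f
         × (∀ p q → E₁ p q ⇔ E₁ (f p) (f q))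
         × (∀ p q → E₂ p q ⇔ E₂ (f p) (f q))

⨆ : (ℕ → ℕ) → (ℕ → K → K) → G → G
⨆ τ s (i , x) = (τ i , s i x)

-- A map preserving E₂ keeps each fibre {i} × K inside a single fibre, because 𝕂_{2,ω} is
-- connected (of diameter 2). Hence every such map is ⨆^τ s for its action τ on fibres and its
-- restrictions s_i to them, and for maps of this form each condition on the whole map splits
-- into conditions on τ and on the s_i: preserving E₁ means τ injective, preserving E₂ means every
-- s_i is an endomorphism, and (once τ is injective) reflecting E₂ and bijectivity split likewise.
module Submission where

open import Defs
open import Data.Bool using (true; not; _≟_)
open import Data.Bool.Properties using (not-¬)
open import Data.Nat using (ℕ)
import Data.Nat.Properties as ℕ
open import Data.Product using (_×_; _,_; proj₁; proj₂; Σ; ∃)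
open import Data.Sum using (_⊎_; inj₁; inj₂)
open import Function using (_∘_; _∘₂_)
open import Function.Bundles using (_⇔_; mk⇔; Equivalence)
open import Function.Consequences.Propositional
  using (surjective⇒strictlySurjective; strictlySurjective⇒surjective)
open import Function.Definitions using (Injective; Bijective; StrictlySurjective)
open import Relation.Binary.PropositionalEquality
  using (_≡_; _≗_; refl; sym; trans; cong; cong₂; subst₂; ≢-sym)
open import Relation.Nullary using (yes; no)
open import Relation.Nullary.Decidable using (decidable-stable)

open Equivalence using (to; from)

Preserves : {A : Set} → (A → A → Set) → (A → A) → Set
Preserves R f = ∀ x y → R x y → R (f x) (f y)

Reflects : {A : Set} → (A → A → Set) → (A → A) → Set
Reflects R f = ∀ x y → R (f x) (f y) → R x y

preserves-reflects⇒⇔ : {A : Set} (R : A → A → Set) (f : A → A) →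
                       Preserves R f → Reflects R f → ∀ x y → R x y ⇔ R (f x) (f y)
preserves-reflects⇒⇔ _ _ pres refls x y = mk⇔ (pres x y) (refls x y)

module _ {A B : Set} {f g : A → B} (f≗g : f ≗ g) where

  Injective-resp-≗ : Injective _≡_ _≡_ g → Injective _≡_ _≡_ f
  Injective-resp-≗ g-inj {x} {y} fx≡fy = g-inj (trans (sym (f≗g x)) (trans fx≡fy (f≗g y)))

  Bijective-resp-≗ : Bijective _≡_ _≡_ g → Bijective _≡_ _≡_ f
  Bijective-resp-≗ (g-inj , g-surj) = Injective-resp-≗ g-inj , strictlySurjective⇒surjective f-surj
    where
    f-surj : StrictlySurjective _≡_ f
    f-surj y with surjective⇒strictlySurjective g-surj y
    ... | x , gx≡y = x , trans (f≗g x) gx≡y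

module _ {A : Set} {R : A → A → Set} {f g : A → A} (f≗g : f ≗ g) where

  Preserves-resp-≗ : Preserves R g → Preserves R f
  Preserves-resp-≗ g-pres x y r = subst₂ R (sym (f≗g x)) (sym (f≗g y)) (g-pres x y r)

  Reflects-resp-≗ : Reflects R g → Reflects R f
  Reflects-resp-≗ g-refl x y r = g-refl x y (subst₂ R (f≗g x) (f≗g y) r)

K-diameter-2 : ∀ x y → Edge x y ⊎ ∃ λ z → Edge x z × Edge z y
K-diameter-2 (a , _) (b , _) with a ≟ b
... | no a≢b  = inj₁ a≢b
... | yes refl = inj₂ ((not a , 0) , not-¬ refl , ≢-sym (not-¬ refl))

layer : (G → G) → ℕ → ℕ
layer f i = proj₁ (f (i , true , 0))

fibreMap : (G → G) → ℕ → K → K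
fibreMap f i x = proj₂ (f (i , x))

module _ {f : G → G} (f-pres : Preserves E₂ f) where

  E₂-preserving⇒edge-in-fibre : ∀ i x y → Edge x y → proj₁ (f (i , x)) ≡ proj₁ (f (i , y))
  E₂-preserving⇒edge-in-fibre i x y x~y = proj₁ (f-pres (i , x) (i , y) (refl , x~y))

  E₂-preserving⇒fibre-to-fibre : ∀ i x y → proj₁ (f (i , x)) ≡ proj₁ (f (i , y))
  E₂-preserving⇒fibre-to-fibre i x y with K-diameter-2 x y
  ... | inj₁ x~y             = E₂-preserving⇒edge-in-fibre i x y x~y
  ... | inj₂ (z , x~z , z~y) =
    trans (E₂-preserving⇒edge-in-fibre i x z x~z) (E₂-preserving⇒edge-in-fibre i z y z~y)

  E₂-preserving⇒≗⨆ : f ≗ ⨆ (layer f) (fibreMap f)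
  E₂-preserving⇒≗⨆ (i , x) = cong₂ _,_ (E₂-preserving⇒fibre-to-fibre i x (true , 0)) refl

module _ (τ : ℕ → ℕ) (s : ℕ → K → K) where

  ⨆-preserves-E₁⇔ : Preserves E₁ (⨆ τ s) ⇔ Injective _≡_ _≡_ τ
  ⨆-preserves-E₁⇔ = mk⇔ ⇒ ⇐
    where
    ⇒ : Preserves E₁ (⨆ τ s) → Injective _≡_ _≡_ τ
    ⇒ pres {i} {j} τi≡τj = decidable-stable (i ℕ.≟ j)
      (λ i≢j → pres (i , true , 0) (j , true , 0) i≢j τi≡τj)
    ⇐ : Injective _≡_ _≡_ τ → Preserves E₁ (⨆ τ s)
    ⇐ τ-inj (i , _) (j , _) i≢j τi≡τj = i≢j (τ-inj τi≡τj)

  ⨆-reflects-E₁ : Reflects E₁ (⨆ τ s)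
  ⨆-reflects-E₁ (i , _) (j , _) τi≢τj i≡j = τi≢τj (cong τ i≡j)

  ⨆-preserves-E₂⇔ : Preserves E₂ (⨆ τ s) ⇔ (∀ i → IsEndK (s i))
  ⨆-preserves-E₂⇔ = mk⇔ ⇒ ⇐
    where
    ⇒ : Preserves E₂ (⨆ τ s) → ∀ i → IsEndK (s i)
    ⇒ pres i x y x~y = proj₂ (pres (i , x) (i , y) (refl , x~y))
    ⇐ : (∀ i → IsEndK (s i)) → Preserves E₂ (⨆ τ s)
    ⇐ s-end (i , x) (.i , y) (refl , x~y) = refl , s-end i x y x~y

  ⨆-reflects-E₂⇔ : Injective _≡_ _≡_ τ → Reflects E₂ (⨆ τ s) ⇔ (∀ i → Reflects Edge (s i))
  ⨆-reflects-E₂⇔ τ-inj = mk⇔ ⇒ ⇐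
    where
    ⇒ : Reflects E₂ (⨆ τ s) → ∀ i → Reflects Edge (s i)
    ⇒ reflects i x y sx~sy = proj₂ (reflects (i , x) (i , y) (refl , sx~sy))
    ⇐ : (∀ i → Reflects Edge (s i)) → Reflects E₂ (⨆ τ s)
    ⇐ s-refl (i , x) (j , y) (τi≡τj , sx~sy) with τ-inj τi≡τj
    ... | refl = refl , s-refl i x y sx~sy

  ⨆-injective : Injective _≡_ _≡_ τ → (∀ i → Injective _≡_ _≡_ (s i)) → Injective _≡_ _≡_ (⨆ τ s)
  ⨆-injective τ-inj s-inj {i , x} {j , y} e with τ-inj (cong proj₁ e)
  ... | refl = cong (i ,_) (s-inj i (cong proj₂ e))

  ⨆-injective⇒ : Injective _≡_ _≡_ (⨆ τ s) → ∀ i → Injective _≡_ _≡_ (s i)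
  ⨆-injective⇒ inj i e = cong proj₂ (inj (cong (τ i ,_) e))

  ⨆-strictlySurjective : StrictlySurjective _≡_ τ → (∀ i → StrictlySurjective _≡_ (s i)) →
                         StrictlySurjective _≡_ (⨆ τ s)
  ⨆-strictlySurjective τ-surj s-surj (k , y) with τ-surj k
  ... | i , refl with s-surj i y
  ... | x , refl = (i , x) , refl

  ⨆-strictlySurjective⇒ˡ : StrictlySurjective _≡_ (⨆ τ s) → StrictlySurjective _≡_ τ
  ⨆-strictlySurjective⇒ˡ surj k with surj (k , true , 0)
  ... | (i , _) , e = i , cong proj₁ e

  ⨆-strictlySurjective⇒ʳ : Injective _≡_ _≡_ τ → StrictlySurjective _≡_ (⨆ τ s) →
                           ∀ i → StrictlySurjective _≡_ (s i)
  ⨆-strictlySurjective⇒ʳ τ-inj surj i y with surj (τ i , y)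
  ... | (j , x) , e with τ-inj (cong proj₁ e)
  ... | refl = x , cong proj₂ e

  ⨆-bijective⇔ : Injective _≡_ _≡_ τ →
                 Bijective _≡_ _≡_ (⨆ τ s) ⇔ (Bijective _≡_ _≡_ τ × ∀ i → Bijective _≡_ _≡_ (s i))
  ⨆-bijective⇔ τ-inj = mk⇔ ⇒ ⇐
    where
    ⇒ : Bijective _≡_ _≡_ (⨆ τ s) → Bijective _≡_ _≡_ τ × ∀ i → Bijective _≡_ _≡_ (s i)
    ⇒ (inj , surj) =
      (τ-inj , strictlySurjective⇒surjective (⨆-strictlySurjective⇒ˡ surj′)) ,
      λ i → ⨆-injective⇒ inj i , strictlySurjective⇒surjective (⨆-strictlySurjective⇒ʳ τ-inj surj′ i)
      where
      surj′ : StrictlySurjective _≡_ (⨆ τ s)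
      surj′ = surjective⇒strictlySurjective surj
    ⇐ : Bijective _≡_ _≡_ τ × (∀ i → Bijective _≡_ _≡_ (s i)) → Bijective _≡_ _≡_ (⨆ τ s)
    ⇐ ((_ , τ-surj) , s-bij) =
      ⨆-injective τ-inj (proj₁ ∘ s-bij) ,
      strictlySurjective⇒surjective (⨆-strictlySurjective (surjective⇒strictlySurjective τ-surj)
                                                           (surjective⇒strictlySurjective ∘ proj₂ ∘ s-bij))

EndDecomposition : (G → G) → Set
EndDecomposition f = Σ (ℕ → ℕ) λ τ → Σ (ℕ → K → K) λ s →
  Injective _≡_ _≡_ τ × (∀ i → IsEndK (s i)) × f ≗ ⨆ τ s

AutDecomposition : (G → G) → Set
AutDecomposition f = Σ (ℕ → ℕ) λ σ → Σ (ℕ → K → K) λ α →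
  Bijective _≡_ _≡_ σ × (∀ i → IsAutK (α i)) × f ≗ ⨆ σ α

IsEndG⇔EndDecomposition : (f : G → G) → IsEndG f ⇔ EndDecomposition f
IsEndG⇔EndDecomposition f = mk⇔ ⇒ ⇐
  where
  ⇒ : IsEndG f → EndDecomposition f
  ⇒ (pres₁ , pres₂) = layer f , fibreMap f ,
    to (⨆-preserves-E₁⇔ (layer f) (fibreMap f)) (Preserves-resp-≗ (sym ∘ f≗⨆) pres₁) ,
    to (⨆-preserves-E₂⇔ (layer f) (fibreMap f)) (Preserves-resp-≗ (sym ∘ f≗⨆) pres₂) ,
    f≗⨆
    where
    f≗⨆ : f ≗ ⨆ (layer f) (fibreMap f)
    f≗⨆ = E₂-preserving⇒≗⨆ pres₂
  ⇐ : EndDecomposition f → IsEndG f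
  ⇐ (τ , s , τ-inj , s-end , f≗⨆) =
    Preserves-resp-≗ f≗⨆ (from (⨆-preserves-E₁⇔ τ s) τ-inj) ,
    Preserves-resp-≗ f≗⨆ (from (⨆-preserves-E₂⇔ τ s) s-end)

IsAutG⇒AutDecomposition : (f : G → G) → IsAutG f → AutDecomposition f
IsAutG⇒AutDecomposition f (f-bij , f-iso₁ , f-iso₂)
  with to (IsEndG⇔EndDecomposition f) (to ∘₂ f-iso₁ , to ∘₂ f-iso₂)
... | τ , s , τ-inj , s-end , f≗⨆ =
  τ , s , proj₁ bij , (λ i → proj₂ bij i , preserves-reflects⇒⇔ Edge (s i) (s-end i) (s-refl i)) , f≗⨆
  where
  bij : Bijective _≡_ _≡_ τ × ∀ i → Bijective _≡_ _≡_ (s i)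
  bij = to (⨆-bijective⇔ τ s τ-inj) (Bijective-resp-≗ (sym ∘ f≗⨆) f-bij)
  s-refl : ∀ i → Reflects Edge (s i)
  s-refl = to (⨆-reflects-E₂⇔ τ s τ-inj) (Reflects-resp-≗ (sym ∘ f≗⨆) (from ∘₂ f-iso₂))

AutDecomposition⇒IsAutG : (f : G → G) → AutDecomposition f → IsAutG f
AutDecomposition⇒IsAutG f (σ , α , σ-bij , α-aut , f≗⨆) =
  Bijective-resp-≗ f≗⨆ (from (⨆-bijective⇔ σ α σ-inj) (σ-bij , proj₁ ∘ α-aut)) ,
  preserves-reflects⇒⇔ E₁ f (Preserves-resp-≗ f≗⨆ (from (⨆-preserves-E₁⇔ σ α) σ-inj))
                            (Reflects-resp-≗ f≗⨆ (⨆-reflects-E₁ σ α)) ,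
  preserves-reflects⇒⇔ E₂ f (Preserves-resp-≗ f≗⨆ (from (⨆-preserves-E₂⇔ σ α) α-end))
                            (Reflects-resp-≗ f≗⨆ (from (⨆-reflects-E₂⇔ σ α σ-inj) α-refl))
  where
  σ-inj : Injective _≡_ _≡_ σ
  σ-inj = proj₁ σ-bij
  α-end : ∀ i → IsEndK (α i)
  α-end i = to ∘₂ proj₂ (α-aut i)
  α-refl : ∀ i → Reflects Edge (α i)
  α-refl i = from ∘₂ proj₂ (α-aut i)

lemma4p5 : ((f : G → G) → IsEndG f ⇔ (Σ (ℕ → ℕ) λ τ → Σ (ℕ → K → K) λ s → Injective _≡_ _≡_ τ × (∀ i → IsEndK (s i)) × (∀ p → f p ≡ ⨆ τ s p)))
    × ((f : G → G) → IsAutG f ⇔ (Σ (ℕ → ℕ) λ σ → Σ (ℕ → K → K) λ α → Bijective _≡_ _≡_ σ × (∀ i → IsAutK (α i)) × (∀ p → f p ≡ ⨆ σ α p)))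
lemma4p5 = IsEndG⇔EndDecomposition ,
           λ f → mk⇔ (IsAutG⇒AutDecomposition f) (AutDecomposition⇒IsAutG f)
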